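{- Let $U=\{e_1,\dots,e_n\}$ and let $\pi,\sigma$ be two rankings of $U$. Then $\mathcal{LR}(\pi,\sigma)=\mathcal{F}(\pi,\sigma)$, where $\mathcal{F}(\pi,\sigma)=\sum_{e\in U}|\pi(e)-\sigma(e)|$ is Spearman's footrule distance and $\mathcal{LR}$ is the LR-distance defined below.
   Context: A ranking of a finite set $U$ with $|U|=n$ is a bijection $\pi:U\to\{1,\dots,n\}$; $\pi(e)$ is the rank of $e$, and the elements listed in increasing rank are $\prec e^\pi_1,\dots,e^\pi_n\succ$. For a ranking $\sigma$, an integer interval $I$ and $e\in U$, let $p(e)^I_\sigma=1$ if $\sigma(e)\in I$ and $0$ otherwise. For $1\le a\le b\le n$, the subranking of $\pi$ with rank interval $[a:b]$ is the consecutive subsequence of $\pi$ consisting of the elements $e$ with $\pi(e)\in[a:b]$. LR-distance: for a subranking $\tau$ of $\pi$ with rank interval $[a:b]$, define $\mathcal{LR}(\tau,\sigma)=0$ if $a\ge b$ (i.e. $\tau$ has at most one element), and otherwise, with $h=\lfloor (a+b)/2\rfloor$, letting $\tau_\ell$ and $\tau_r$ be the subrankings of $\pi$ with rank intervals $[a:h]$ and $[h+1:b]$, $$\mathcal{LR}(\tau,\sigma)=\sum_{e:\ \pi(e)\in[1:h]} p(e)^{[h+1:n]}_\sigma+\mathcal{LR}(\tau_\ell,\sigma)+\sum_{e:\ \pi(e)\in[h+1:n]} p(e)^{[1:h]}_\sigma+\mathcal{LR}(\tau_r,\sigma).$$ (Here $[1:h]$ and $[h+1:n]$ are the left-extended interval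 of $\tau_\ell$ and the right-extended interval of $\tau_r$ with respect to $\pi$.) Finally $\mathcal{LR}(\pi,\sigma)$ is this quantity for $\tau=\pi$, i.e. rank interval $[1:n]$. -}

module Defs where

open import Data.Nat using (ℕ; zero; suc; _+_; _<ᵇ_; _≤ᵇ_; _/_; ∣_-_∣)
open import Data.Bool using (Bool; true; false; if_then_else_; _∧_)
open import Data.Fin using (Fin; toℕ)
open import Data.List using (List; map; allFin)
open import Data.Nat.ListAction using (sum)
open import Function.Bundles using (_⤖_; Bijection)

-- The ground set U = {e_1,…,e_n} is modelled as Fin n.
-- A ranking is a bijection U → {1,…,n}; we represent {1,…,n} by Fin n
-- (via i ↦ toℕ i + 1).
Ranking : ℕ → Set
Ranking n = Fin n ⤖ Fin n

rank : {n : ℕ} → Ranking n → Fin n → ℕ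
rank π e = suc (toℕ (Bijection.to π e))

p : {n : ℕ} → Ranking n → ℕ → ℕ → Fin n → ℕ
p σ lo hi e = if (lo ≤ᵇ rank σ e) ∧ (rank σ e ≤ᵇ hi) then 1 else 0

inI : {n : ℕ} → Ranking n → ℕ → ℕ → Fin n → ℕ
inI = p

crossSum : {n : ℕ} → Ranking n → Ranking n → ℕ → ℕ → ℕ → ℕ → ℕ
crossSum {n} π σ lo hi lo' hi' =
  sum (map (λ e → inI π lo hi e Data.Nat.* p σ lo' hi' e) (allFin n))

-- LR(τ, σ) for the subranking τ of π with rank interval [a:b].
-- The recursion is on a fuel argument; fuel n suffices for the top call
-- since each recursive call strictly shrinks the interval length (≤ n).
LRaux : {n : ℕ} → Ranking n → Ranking n → ℕ → ℕ → ℕ → ℕ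
LRaux π σ zero a b = 0
LRaux {n} π σ (suc f) a b with a <ᵇ b
... | false = 0
... | true =
  let h = (a + b) / 2 in
    crossSum π σ 1 h (suc h) n + LRaux π σ f a h
  + crossSum π σ (suc h) n 1 h + LRaux π σ f (suc h) b

LR : {n : ℕ} → Ranking n → Ranking n → ℕ
LR {n} π σ = LRaux π σ n 1 n

footrule : {n : ℕ} → Ranking n → Ranking n → ℕ
footrule {n} π σ = sum (map (λ e → ∣ rank π e - rank σ e ∣) (allFin n))

-- Because each half of the recursion is charged against the extended intervals [1:h] and
-- [h+1:n], the amount added at a node depends only on its split point h: it is the number
-- of elements e that h separates, i.e. with π(e) ≤ h < σ(e) or σ(e) ≤ h < π(e). The split
-- points of the recursion on [1:n] are 1, …, n−1, each occurring exactly once, so LR(π,σ) is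
-- the sum over h of that count. Exchanging the two sums, each e is counted once for every h
-- between π(e) and σ(e), that is |π(e) − σ(e)| times.
module Submission where

open import Defs
open import Data.Nat using (ℕ)
open import Relation.Binary.PropositionalEquality using (_≡_)

open import Data.Bool using (Bool; true; false; if_then_else_; _∧_)
open import Data.Bool.Properties using (∧-identityʳ; T-≡)
open import Data.Fin using (Fin)
open import Data.Fin.Properties using (toℕ<n)
open import Data.List using (List; []; _∷_; _++_; map; iterate; allFin)
open import Data.List.Properties using (map-++; map-cong)
open import Data.Nat
  using (suc; zero; _+_; _*_; _∸_; _⊔_; _≤_; _<_; _≤ᵇ_; _<ᵇ_; _/_; ∣_-_∣; z≤n; s≤s; s≤s⁻¹)
open import Data.Nat.DivMod using (m*n/n≡m; /-monoˡ-≤; m<n*o⇒m/o<n)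
open import Data.Nat.ListAction using (sum)
open import Data.Nat.ListAction.Properties using (sum-++)
open import Data.Nat.Properties
open import Data.Nat.Tactic.RingSolver using (solve-∀)
open import Function.Bundles using (Bijection; Equivalence)
open import Relation.Binary.PropositionalEquality
  using (refl; sym; trans; cong; cong₂; subst; module ≡-Reasoning)
open import Relation.Nullary.Reflects using (ofʸ; ofⁿ)

open import Algebra.Properties.CommutativeSemigroup +-commutativeSemigroup
  using () renaming (interchange to +-interchange)

open ≡-Reasoning

sum-map-+ : ∀ {a} {A : Set a} (f g : A → ℕ) (xs : List A) →
            sum (map (λ x → f x + g x) xs) ≡ sum (map f xs) + sum (map g xs)
sum-map-+ f g []       = refl
sum-map-+ f g (x ∷ xs) =
  trans (cong (f x + g x +_) (sum-map-+ f g xs)) (+-interchange (f x) (g x) _ _)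

sum-map-zero : ∀ {a} {A : Set a} (xs : List A) → sum (map (λ _ → 0) xs) ≡ 0
sum-map-zero []       = refl
sum-map-zero (x ∷ xs) = sum-map-zero xs

sum-map-comm : ∀ {a b} {A : Set a} {B : Set b} (F : A → B → ℕ) (xs : List A) (ys : List B) →
               sum (map (λ x → sum (map (F x) ys)) xs)
               ≡ sum (map (λ y → sum (map (λ x → F x y) xs)) ys)
sum-map-comm F []       ys = sym (sum-map-zero ys)
sum-map-comm F (x ∷ xs) ys =
  trans (cong (sum (map (F x) ys) +_) (sum-map-comm F xs ys)) (sym (sum-map-+ (F x) _ ys))

[_⋯_⟩ : ℕ → ℕ → List ℕ
[ a ⋯ b ⟩ = iterate suc a (b ∸ a)

iterate-suc-+ : ∀ a k m → iterate suc a (k + m) ≡ iterate suc a k ++ iterate suc (a + k) m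
iterate-suc-+ a zero    m rewrite +-identityʳ a = refl
iterate-suc-+ a (suc k) m rewrite +-suc a k = cong (a ∷_) (iterate-suc-+ (suc a) k m)

[⋯⟩-split : ∀ {a h b} → a ≤ h → h < b → [ a ⋯ b ⟩ ≡ [ a ⋯ h ⟩ ++ h ∷ [ suc h ⋯ b ⟩
[⋯⟩-split {a} {h} {b} a≤h h<b = begin
  iterate suc a (b ∸ a)                           ≡⟨ cong (iterate suc a) b∸a≡ ⟩
  iterate suc a ((h ∸ a) + (b ∸ h))               ≡⟨ iterate-suc-+ a (h ∸ a) (b ∸ h) ⟩
  [ a ⋯ h ⟩ ++ iterate suc (a + (h ∸ a)) (b ∸ h)
    ≡⟨ cong (λ c → [ a ⋯ h ⟩ ++ iterate suc c (b ∸ h)) (m+[n∸m]≡n a≤h) ⟩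
  [ a ⋯ h ⟩ ++ [ h ⋯ b ⟩
    ≡⟨ cong (λ k → [ a ⋯ h ⟩ ++ iterate suc h k) (+-∸-assoc 1 h<b) ⟩
  [ a ⋯ h ⟩ ++ h ∷ [ suc h ⋯ b ⟩                  ∎
  where
  b∸a≡ : b ∸ a ≡ (h ∸ a) + (b ∸ h)
  b∸a≡ = begin
    b ∸ a             ≡⟨ cong (_∸ a) (sym (m∸n+n≡m (<⇒≤ h<b))) ⟩
    (b ∸ h) + h ∸ a   ≡⟨ +-∸-assoc (b ∸ h) a≤h ⟩
    (b ∸ h) + (h ∸ a) ≡⟨ +-comm (b ∸ h) (h ∸ a) ⟩
    (h ∸ a) + (b ∸ h) ∎

ind : Bool → ℕ
ind b = if b then 1 else 0

ind-∧ : ∀ b c → ind (b ∧ c) ≡ ind b * ind c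
ind-∧ true  c = sym (+-identityʳ (ind c))
ind-∧ false c = refl

⟦_≤_<_⟧ : ℕ → ℕ → ℕ → ℕ
⟦ x ≤ h < y ⟧ = ind ((x ≤ᵇ h) ∧ (h <ᵇ y))

separates : ℕ → ℕ → ℕ → ℕ
separates x y h = ⟦ x ≤ h < y ⟧ + ⟦ y ≤ h < x ⟧

m∸n≡[n<ᵇm]+m∸1+n : ∀ m n → m ∸ n ≡ ind (n <ᵇ m) + (m ∸ suc n)
m∸n≡[n<ᵇm]+m∸1+n zero    zero    = refl
m∸n≡[n<ᵇm]+m∸1+n (suc m) zero    = refl
m∸n≡[n<ᵇm]+m∸1+n zero    (suc n) = refl
m∸n≡[n<ᵇm]+m∸1+n (suc m) (suc n) = m∸n≡[n<ᵇm]+m∸1+n m n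

∸⊔-step : ∀ x y a → y ∸ (x ⊔ a) ≡ ⟦ x ≤ a < y ⟧ + (y ∸ (x ⊔ suc a))
∸⊔-step x y a with x ≤ᵇ a | ≤ᵇ-reflects-≤ x a
... | true  | ofʸ x≤a = begin
  y ∸ (x ⊔ a)                      ≡⟨ cong (y ∸_) (m≤n⇒m⊔n≡n x≤a) ⟩
  y ∸ a                            ≡⟨ m∸n≡[n<ᵇm]+m∸1+n y a ⟩
  ind (a <ᵇ y) + (y ∸ suc a)
    ≡⟨ cong (λ c → ind (a <ᵇ y) + (y ∸ c)) (m≤n⇒m⊔n≡n (m≤n⇒m≤1+n x≤a)) ⟨
  ind (a <ᵇ y) + (y ∸ (x ⊔ suc a)) ∎
... | false | ofⁿ x≰a = cong (y ∸_) (trans (m≥n⇒m⊔n≡m (<⇒≤ a<x)) (sym (m≥n⇒m⊔n≡m a<x)))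
  where a<x = ≰⇒> x≰a

sum-⟦≤<⟧-iterate : ∀ x y a k → y ≤ a + k →
                   sum (map (λ h → ⟦ x ≤ h < y ⟧) (iterate suc a k)) ≡ y ∸ (x ⊔ a)
sum-⟦≤<⟧-iterate x y a zero    y≤a+0 =
  sym (m≤n⇒m∸n≡0 (≤-trans (subst (y ≤_) (+-identityʳ a) y≤a+0) (m≤n⊔m x a)))
sum-⟦≤<⟧-iterate x y a (suc k) y≤a+1+k =
  trans (cong (⟦ x ≤ a < y ⟧ +_) (sum-⟦≤<⟧-iterate x y (suc a) k y≤1+a+k)) (sym (∸⊔-step x y a))
  where y≤1+a+k = subst (y ≤_) (+-suc a k) y≤a+1+k

sum-⟦≤<⟧ : ∀ {a b x y} → a ≤ x → y ≤ b →
           sum (map (λ h → ⟦ x ≤ h < y ⟧) [ a ⋯ b ⟩) ≡ y ∸ x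
sum-⟦≤<⟧ {a} {b} {x} {y} a≤x y≤b =
  trans (sum-⟦≤<⟧-iterate x y a (b ∸ a) (≤-trans y≤b (m≤n+m∸n b a)))
        (cong (y ∸_) (m≥n⇒m⊔n≡m a≤x))

∣m-n∣≡n∸m+m∸n : ∀ m n → ∣ m - n ∣ ≡ (n ∸ m) + (m ∸ n)
∣m-n∣≡n∸m+m∸n zero    zero    = refl
∣m-n∣≡n∸m+m∸n zero    (suc n) = sym (+-identityʳ (suc n))
∣m-n∣≡n∸m+m∸n (suc m) zero    = refl
∣m-n∣≡n∸m+m∸n (suc m) (suc n) = ∣m-n∣≡n∸m+m∸n m n

sum-separates : ∀ {a b x y} → a ≤ x → a ≤ y → x ≤ b → y ≤ b →
                sum (map (separates x y) [ a ⋯ b ⟩) ≡ ∣ x - y ∣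
sum-separates {a} {b} {x} {y} a≤x a≤y x≤b y≤b = begin
  sum (map (separates x y) [ a ⋯ b ⟩)
    ≡⟨ sum-map-+ _ _ [ a ⋯ b ⟩ ⟩
  sum (map (λ h → ⟦ x ≤ h < y ⟧) [ a ⋯ b ⟩) + sum (map (λ h → ⟦ y ≤ h < x ⟧) [ a ⋯ b ⟩)
    ≡⟨ cong₂ _+_ (sum-⟦≤<⟧ a≤x y≤b) (sum-⟦≤<⟧ a≤y x≤b) ⟩
  (y ∸ x) + (x ∸ y)
    ≡⟨ ∣m-n∣≡n∸m+m∸n x y ⟨
  ∣ x - y ∣ ∎

m≤n⇒m≤[m+n]/2 : ∀ {m n} → m ≤ n → m ≤ (m + n) / 2
m≤n⇒m≤[m+n]/2 {m} {n} m≤n = subst (_≤ (m + n) / 2) (m*n/n≡m m 2) (/-monoˡ-≤ 2 m*2≤m+n)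
  where
  m*2≤m+n : m * 2 ≤ m + n
  m*2≤m+n rewrite *-comm m 2 | +-identityʳ m = +-monoʳ-≤ m m≤n

m<n⇒[m+n]/2<n : ∀ {m n} → m < n → (m + n) / 2 < n
m<n⇒[m+n]/2<n {m} {n} m<n = m<n*o⇒m/o<n m+n<n*2
  where
  m+n<n*2 : m + n < n * 2
  m+n<n*2 rewrite *-comm n 2 | +-identityʳ n = +-monoˡ-< n m<n

rank≤n : ∀ {n} (τ : Ranking n) (e : Fin n) → rank τ e ≤ n
rank≤n τ e = toℕ<n (Bijection.to τ e)

p-upTo-n : ∀ {n} (τ : Ranking n) (lo : ℕ) (e : Fin n) → p τ lo n e ≡ ind (lo ≤ᵇ rank τ e)
p-upTo-n τ lo e = cong ind (trans (cong ((lo ≤ᵇ rank τ e) ∧_) rank≤ᵇn) (∧-identityʳ _))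
  where rank≤ᵇn = Equivalence.to T-≡ (≤⇒≤ᵇ (rank≤n τ e))

p-prefix*p-suffix : ∀ {n} (τ ρ : Ranking n) (h : ℕ) (e : Fin n) →
                    p τ 1 h e * p ρ (suc h) n e ≡ ⟦ rank τ e ≤ h < rank ρ e ⟧
p-prefix*p-suffix {n} τ ρ h e = begin
  ind (rank τ e ≤ᵇ h) * p ρ (suc h) n e
    ≡⟨ cong (ind (rank τ e ≤ᵇ h) *_) (p-upTo-n ρ (suc h) e) ⟩
  ind (rank τ e ≤ᵇ h) * ind (h <ᵇ rank ρ e)
    ≡⟨ ind-∧ (rank τ e ≤ᵇ h) (h <ᵇ rank ρ e) ⟨
  ⟦ rank τ e ≤ h < rank ρ e ⟧ ∎

module _ {n : ℕ} (π σ : Ranking n) where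

  cut : ℕ → ℕ
  cut h = crossSum π σ 1 h (suc h) n + crossSum π σ (suc h) n 1 h

  LRaux≡sum-cut : ∀ f a b → b ∸ a ≤ f → LRaux π σ f a b ≡ sum (map cut [ a ⋯ b ⟩)
  LRaux≡sum-cut zero    a b b∸a≤0 rewrite n≤0⇒n≡0 b∸a≤0 = refl
  LRaux≡sum-cut (suc f) a b b∸a≤1+f with a <ᵇ b | <ᵇ-reflects-< a b
  ... | false | ofⁿ a≮b rewrite m≤n⇒m∸n≡0 (≮⇒≥ a≮b) = refl
  ... | true  | ofʸ a<b = begin
    cross₁ + LRaux π σ f a h + cross₂ + LRaux π σ f (suc h) b
      ≡⟨ cong₂ (λ l r → cross₁ + l + cross₂ + r) (LRaux≡sum-cut f a h h∸a≤f)
                                                 (LRaux≡sum-cut f (suc h) b b∸1+h≤f) ⟩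
    cross₁ + Σ[ a ⋯ h ⟩ + cross₂ + Σ[ suc h ⋯ b ⟩
      ≡⟨ regroup cross₁ Σ[ a ⋯ h ⟩ cross₂ Σ[ suc h ⋯ b ⟩ ⟩
    Σ[ a ⋯ h ⟩ + (cut h + Σ[ suc h ⋯ b ⟩)
      ≡⟨ trans (cong sum (map-++ cut [ a ⋯ h ⟩ _)) (sum-++ (map cut [ a ⋯ h ⟩) _) ⟨
    sum (map cut ([ a ⋯ h ⟩ ++ h ∷ [ suc h ⋯ b ⟩))
      ≡⟨ cong (λ hs → sum (map cut hs)) ([⋯⟩-split a≤h h<b) ⟨
    sum (map cut [ a ⋯ b ⟩) ∎
    where
    h = (a + b) / 2
    cross₁ = crossSum π σ 1 h (suc h) n
    cross₂ = crossSum π σ (suc h) n 1 h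
    Σ[_⋯_⟩ : ℕ → ℕ → ℕ
    Σ[ c ⋯ d ⟩ = sum (map cut [ c ⋯ d ⟩)
    a≤h : a ≤ h
    a≤h = m≤n⇒m≤[m+n]/2 (<⇒≤ a<b)
    h<b : h < b
    h<b = m<n⇒[m+n]/2<n a<b
    h∸a≤f : h ∸ a ≤ f
    h∸a≤f = s≤s⁻¹ (<-≤-trans (∸-monoˡ-< h<b a≤h) b∸a≤1+f)
    b∸1+h≤f : b ∸ suc h ≤ f
    b∸1+h≤f = s≤s⁻¹ (<-≤-trans (∸-monoʳ-< (s≤s a≤h) h<b) b∸a≤1+f)
    regroup : ∀ c₁ l c₂ r → c₁ + l + c₂ + r ≡ l + (c₁ + c₂ + r)
    regroup = solve-∀

  cut≡sum-separates : ∀ h →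
                      cut h ≡ sum (map (λ e → separates (rank π e) (rank σ e) h) (allFin n))
  cut≡sum-separates h =
    trans (sym (sum-map-+ _ _ (allFin n))) (cong sum (map-cong pointwise (allFin n)))
    where
    pointwise : ∀ e → inI π 1 h e * p σ (suc h) n e + inI π (suc h) n e * p σ 1 h e
                      ≡ separates (rank π e) (rank σ e) h
    pointwise e = cong₂ _+_ (p-prefix*p-suffix π σ h e)
                            (trans (*-comm (p π (suc h) n e) _) (p-prefix*p-suffix σ π h e))

theorem1 : (n : ℕ) (π σ : Ranking n) → LR π σ ≡ footrule π σ
theorem1 n π σ = begin
  LRaux π σ n 1 n
    ≡⟨ LRaux≡sum-cut π σ n 1 n (m∸n≤m n 1) ⟩
  sum (map (cut π σ) [ 1 ⋯ n ⟩)
    ≡⟨ cong sum (map-cong (cut≡sum-separates π σ) [ 1 ⋯ n ⟩) ⟩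
  sum (map (λ h → sum (map (λ e → separates (rank π e) (rank σ e) h) (allFin n))) [ 1 ⋯ n ⟩)
    ≡⟨ sum-map-comm (λ h e → separates (rank π e) (rank σ e) h) [ 1 ⋯ n ⟩ (allFin n) ⟩
  sum (map (λ e → sum (map (separates (rank π e) (rank σ e)) [ 1 ⋯ n ⟩)) (allFin n))
    ≡⟨ cong sum (map-cong separated-ranks (allFin n)) ⟩
  footrule π σ ∎
  where
  separated-ranks : ∀ e → sum (map (separates (rank π e) (rank σ e)) [ 1 ⋯ n ⟩)
                          ≡ ∣ rank π e - rank σ e ∣
  separated-ranks e = sum-separates (s≤s z≤n) (s≤s z≤n) (rank≤n π e) (rank≤n σ e)
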